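{- Let $\Sigma=\Sigma_c\,\dot\cup\,\Sigma_{uc}$ be a finite alphabet, let $L^*_P\subseteq\Sigma^*$ be prefix-closed, let $\mathcal{L}_P\subseteq\Sigma^\omega$ with $\mathrm{Pre}(\mathcal{L}_P)\subseteq L^*_P$, and let $\mathcal{L}_S\subseteq\Sigma^\omega$. Suppose $(M,\mathcal{F}^S_P,\mathcal{F}^R_S)$ is a Streett/Rabin supervisor synthesis automaton realizing $((L^*_P,\mathcal{L}_P),\mathcal{L}_S)$. Let $f:\Sigma^*\to\Gamma$ be a string-based supervisor and $\check f:P(M)\to\Gamma$ a path-based supervisor such that for all $s\in L^*(M)$ we have $f(s)=\check f(\pi_s)$, where $\pi_s$ is the unique element of $\mathrm{Paths}_M(s)$. Then $f$ solves the string-based supervisor synthesis problem over $((L^*_P,\mathcal{L}_P),\mathcal{L}_S)$ if and only if $\check f$ solves the path-based supervisor synthesis problem over $(M,\mathcal{F}^S_P,\mathcal{F}^R_S)$.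
   Context: Words and languages: for a finite alphabet $\Sigma$, $\Sigma^*$ and $\Sigma^\omega$ are the finite and infinite words. For a word $w$, $\mathrm{Pre}(w)$ is the set of its finite prefixes; for a language $L$, $\mathrm{Pre}(L)=\bigcup_{w\in L}\mathrm{Pre}(w)$; $L$ is prefix-closed if $L=\mathrm{Pre}(L)$. For $L\subseteq\Sigma^*$, $\mathrm{Lim}(L)$ is the set of $\alpha\in\Sigma^\omega$ having infinitely many prefixes in $L$ (the same operator is applied to sets of finite state sequences). Control patterns and string-based supervisors: $\Gamma=\{\gamma\subseteq\Sigma:\Sigma_{uc}\subseteq\gamma\}$. A string-based supervisor is a map $f:\Sigma^*\to\Gamma$. A word $s\in\Sigma^*$ is consistent with $f$ if for all $t\in\Sigma^*$, $\sigma\in\Sigma$ with $t\sigma\in\mathrm{Pre}(s)$ we have $\sigma\in f(t)$; $L^*_f$ is the set of words consistent with $f$ and $\mathcal{L}_f=\mathrm{Lim}(L^*_f)$. $f$ solves the string-based supervisor synthesis problem over $((L^*_P,\mathcal{L}_P),\mathcal{L}_S)$ if (i) $\emptyset\subsetneq \mathcal{L}_f\cap\mathcal{L}_P\subseteq\mathcal{L}_S$ and (ii) $L^*_f\cap L^*_P\subseteq\mathrm{Pre}(\mathcal{L}_f\cap\mathcal{L}_P)$. Finite state machines: $M=(X,\Sigma,\delta,x_0)$ with finite state set $X$, initial state $x_0$, partial transition function $\delta:X\times\Sigma\rightharpoonup 2^X$; $M$ is deterministic if whenever $\delta(x,\sigma)$ is defined it is a singleton. A path is a finite or infinite sequence $\pi=x_0x_1\dots$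 such that for each consecutive pair there is $\sigma_k$ with $x_{k+1}\in\delta(x_k,\sigma_k)$; $P(M)$ (resp. $\mathcal{P}(M)$) is the set of finite (resp. infinite) paths. For $s=\sigma_0\sigma_1\dots\in\Sigma^*\cup\Sigma^\omega$, $\mathrm{Paths}_M(s)$ is the set of paths $x_0x_1\dots$ of length $|s|+1$ with $x_{k+1}\in\delta(x_k,\sigma_k)$ for all $k$. $L^*(M)=\{s\in\Sigma^*:\mathrm{Paths}_M(s)\neq\emptyset\}$, $\mathcal{L}(M)=\{s\in\Sigma^\omega:\mathrm{Paths}_M(s)\ne\emptyset\}$. For an infinite path $\pi$, $\mathrm{Inf}(\pi)$ is the set of states occurring infinitely often. For a family $\mathcal{F}=\{(G_1,R_1),\dots,(G_m,R_m)\}$ of pairs of subsets of $X$: $\pi$ satisfies the Rabin condition $\mathcal{F}$ if there is $i$ with $\mathrm{Inf}(\pi)\cap G_i\neq\emptyset$ and $\mathrm{Inf}(\pi)\cap R_i=\emptyset$; it satisfies the Streett condition $\mathcal{F}$ if for all $i$, $\mathrm{Inf}(\pi)\cap G_i=\emptyset$ or $\mathrm{Inf}(\pi)\cap R_i\ne\emptyset$. $\mathcal{P}(M,\mathcal{F})$ is the set of infinite paths satisfying $\mathcal{F}$ and $\mathcal{L}(M,\mathcal{F})$ the set of $s\in\Sigma^\omega$ having some path in $\mathrm{Paths}_M(s)$ satisfying $\mathcal{F}$. Synthesis automaton: $(M,\mathcal{F}^S_P,\mathcal{F}^R_S)$, with $\mathcal{F}^S_P$ a Streett condition and $\mathcal{F}^R_S$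 a Rabin condition over $M$, is a Streett/Rabin supervisor synthesis automaton realizing $((L^*_P,\mathcal{L}_P),\mathcal{L}_S)$ if (a) $L^*_P=L^*(M)$, (b) $\mathcal{L}_P=\mathcal{L}(M,\mathcal{F}^S_P)$, (c) $\mathcal{L}_S=\mathcal{L}(M,\mathcal{F}^R_S)$, (d) $M$ is deterministic, and (e) for all $x\in X$ and $\sigma,\sigma'\in\Sigma$ with $\delta(x,\sigma),\delta(x,\sigma')$ defined, $\delta(x,\sigma)=\delta(x,\sigma')$ implies $\sigma=\sigma'$. Path-based supervisors: a map $\check f:P(M)\to\Gamma$. A path $\pi$ is consistent with $\check f$ if for all $x,x'\in X$ and $\nu\in X^*$ with $\nu x x'$ a prefix of $\pi$ there is $\sigma\in\check f(\nu x)$ with $\delta(x,\sigma)=\{x'\}$. $P(M,\check f)$ is the set of finite paths consistent with $\check f$ and $\mathcal{P}(M,\check f)=\mathrm{Lim}(P(M,\check f))$. $\check f$ solves the path-based supervisor synthesis problem over $(M,\mathcal{F}^S_P,\mathcal{F}^R_S)$ if $\emptyset\subsetneq\mathcal{P}(M,\check f)\cap\mathcal{P}(M,\mathcal{F}^S_P)\subseteq\mathcal{P}(M,\mathcal{F}^R_S)$ and $P(M,\check f)\subseteq\mathrm{Pre}(\mathcal{P}(M,\check f)\cap\mathcal{P}(M,\mathcal{F}^S_P))$. -}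

module Defs where

open import Data.Nat using (ℕ; zero; suc; _≤_)
open import Data.Fin using (Fin)
open import Data.Fin.Subset using (Subset; _∈_; _∉_; _⊆_; ⁅_⁆)
open import Data.List using (List; []; _∷_; _++_; _∷ʳ_; length)
open import Data.Maybe using (Maybe; just)
open import Data.Product using (Σ; ∃; ∃-syntax; _×_; _,_; proj₁; proj₂)
open import Data.Sum using (_⊎_)
open import Data.Empty using (⊥)
open import Data.Unit using (⊤)
open import Relation.Nullary using (¬_)
open import Relation.Binary.PropositionalEquality using (_≡_)
open import Function.Bundles using (_⇔_)

-- Words and languages.  The finite alphabet Σ is Fin k.
-- Finite words: List (Fin k); infinite words: ℕ → Fin k.

takeω : {A : Set} → ℕ → (ℕ → A) → List A
takeω zero    α = []
takeω (suc n) α = α 0 ∷ takeω n (λ i → α (suc i))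

IsPrefix : {A : Set} → List A → List A → Set
IsPrefix t s = ∃[ u ] (t ++ u ≡ s)

IsPrefixω : {A : Set} → List A → (ℕ → A) → Set
IsPrefixω t α = t ≡ takeω (length t) α

Pre : {A : Set} → (List A → Set) → List A → Set
Pre L s = ∃[ w ] (L w × IsPrefix s w)

Preω : {A : Set} → ((ℕ → A) → Set) → List A → Set
Preω L s = ∃[ α ] (L α × IsPrefixω s α)

PrefixClosed : {A : Set} → (List A → Set) → Set
PrefixClosed L = ∀ s → (L s ⇔ Pre L s)

Lim : {A : Set} → (List A → Set) → (ℕ → A) → Set
Lim L α = ∀ n → ∃[ m ] (n ≤ m × L (takeω m α))

-- Control patterns: subsets of Σ containing Σ_uc (uc : Subset k);
-- Σ_c is the complement of uc.

record Γ {k : ℕ} (uc : Subset k) : Set where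
  field
    pat  : Subset k
    ucOk : uc ⊆ pat
open Γ public

ConsistentStr : {k : ℕ} {uc : Subset k} → (List (Fin k) → Γ uc) → List (Fin k) → Set
ConsistentStr {k} f s = ∀ (t : List (Fin k)) (σ : Fin k) → IsPrefix (t ∷ʳ σ) s → σ ∈ pat (f t)

Lstar-f : {k : ℕ} {uc : Subset k} → (List (Fin k) → Γ uc) → List (Fin k) → Set
Lstar-f f = ConsistentStr f

Lω-f : {k : ℕ} {uc : Subset k} → (List (Fin k) → Γ uc) → (ℕ → Fin k) → Set
Lω-f f = Lim (Lstar-f f)

SolvesStr : {k : ℕ} {uc : Subset k} → (List (Fin k) → Γ uc) →
            (LP : List (Fin k) → Set) (𝓛P 𝓛S : (ℕ → Fin k) → Set) → Set
SolvesStr f LP 𝓛P 𝓛S =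
  (∃[ α ] (Lω-f f α × 𝓛P α)) ×
  (∀ α → Lω-f f α → 𝓛P α → 𝓛S α) ×
  (∀ s → Lstar-f f s → LP s → Preω (λ α → Lω-f f α × 𝓛P α) s)

-- Finite state machines with states Fin N over alphabet Fin k.
-- δ : X × Σ ⇀ 2^X  is  X → Σ → Maybe (Subset N)  (nothing = undefined).

record FSM (k N : ℕ) : Set where
  field
    δ  : Fin N → Fin k → Maybe (Subset N)
    x₀ : Fin N
open FSM public

module _ {k N : ℕ} (M : FSM k N) where

  InDelta : Fin N → Fin k → Fin N → Set
  InDelta x σ x' = ∃[ S ] (δ M x σ ≡ just S × x' ∈ S)

  Step : Fin N → Fin N → Set
  Step x x' = ∃[ σ ] InDelta x σ x'

  Steps : Fin N → List (Fin N) → Set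
  Steps x []        = ⊤
  Steps x (y ∷ ys)  = Step x y × Steps y ys

  IsPath : List (Fin N) → Set
  IsPath []       = ⊥
  IsPath (x ∷ xs) = x ≡ x₀ M × Steps x xs

  IsPathω : (ℕ → Fin N) → Set
  IsPathω π = π 0 ≡ x₀ M × (∀ i → Step (π i) (π (suc i)))

  data Run : Fin N → List (Fin k) → List (Fin N) → Set where
    run-nil  : ∀ {x} → Run x [] (x ∷ [])
    run-cons : ∀ {x y σ s ys} → InDelta x σ y → Run y s ys → Run x (σ ∷ s) (x ∷ ys)

  PathsOf : List (Fin k) → List (Fin N) → Set
  PathsOf s π = Run (x₀ M) s π

  PathsOfω : (ℕ → Fin k) → (ℕ → Fin N) → Set
  PathsOfω α π = π 0 ≡ x₀ M × (∀ i → InDelta (π i) (α i) (π (suc i)))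

  Lstar-M : List (Fin k) → Set
  Lstar-M s = ∃[ π ] PathsOf s π

  Lω-M : (ℕ → Fin k) → Set
  Lω-M α = ∃[ π ] PathsOfω α π

  Inf : (ℕ → Fin N) → Fin N → Set
  Inf π x = ∀ n → ∃[ m ] (n ≤ m × π m ≡ x)

  Family : Set
  Family = Σ ℕ (λ m → Fin m → Subset N × Subset N)

  Rabin : Family → (ℕ → Fin N) → Set
  Rabin (m , F) π = ∃[ i ] ((∃[ x ] (x ∈ proj₁ (F i) × Inf π x)) ×
                            (∀ x → x ∈ proj₂ (F i) → ¬ Inf π x))

  Streett : Family → (ℕ → Fin N) → Set
  Streett (m , F) π = ∀ i → (∀ x → x ∈ proj₁ (F i) → ¬ Inf π x) ⊎
                            (∃[ x ] (x ∈ proj₂ (F i) × Inf π x))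

  PathsRabin : Family → (ℕ → Fin N) → Set
  PathsRabin F π = IsPathω π × Rabin F π

  PathsStreett : Family → (ℕ → Fin N) → Set
  PathsStreett F π = IsPathω π × Streett F π

  LRabin : Family → (ℕ → Fin k) → Set
  LRabin F α = ∃[ π ] (PathsOfω α π × Rabin F π)

  LStreett : Family → (ℕ → Fin k) → Set
  LStreett F α = ∃[ π ] (PathsOfω α π × Streett F π)

  Deterministic : Set
  Deterministic = ∀ x σ S → δ M x σ ≡ just S → ∃[ x' ] (S ≡ ⁅ x' ⁆)

  DistinctSuccessors : Set
  DistinctSuccessors = ∀ x σ σ' S → δ M x σ ≡ just S → δ M x σ' ≡ just S → σ ≡ σ'

  Realizes : Family → Family → (List (Fin k) → Set) → ((ℕ → Fin k) → Set) →
             ((ℕ → Fin k) → Set) → Set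
  Realizes FP FS LP 𝓛P 𝓛S =
    (∀ s → (LP s ⇔ Lstar-M s)) ×
    (∀ α → (𝓛P α ⇔ LStreett FP α)) ×
    (∀ α → (𝓛S α ⇔ LRabin FS α)) ×
    Deterministic × DistinctSuccessors

  -- Path-based supervisors f̌ : P(M) → Γ, represented as total maps on
  -- finite state sequences (values outside P(M) are irrelevant).

  ConsistentPath : {uc : Subset k} → (List (Fin N) → Γ uc) → List (Fin N) → Set
  ConsistentPath fˇ π =
    ∀ (ν : List (Fin N)) (x x' : Fin N) → IsPrefix (ν ∷ʳ x ∷ʳ x') π →
      ∃[ σ ] (σ ∈ pat (fˇ (ν ∷ʳ x)) × δ M x σ ≡ just ⁅ x' ⁆)

  P-f : {uc : Subset k} → (List (Fin N) → Γ uc) → List (Fin N) → Set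
  P-f fˇ π = IsPath π × ConsistentPath fˇ π

  𝓟-f : {uc : Subset k} → (List (Fin N) → Γ uc) → (ℕ → Fin N) → Set
  𝓟-f fˇ = Lim (P-f fˇ)

  SolvesPath : {uc : Subset k} → (List (Fin N) → Γ uc) → Family → Family → Set
  SolvesPath fˇ FP FS =
    (∃[ π ] (𝓟-f fˇ π × PathsStreett FP π)) ×
    (∀ π → 𝓟-f fˇ π → PathsStreett FP π → PathsRabin FS π) ×
    (∀ π → P-f fˇ π → Preω (λ ρ → 𝓟-f fˇ ρ × PathsStreett FP ρ) π)

-- Since M is deterministic, every word s ∈ L*(M) has exactly one run π_s, and every infinite
-- word of 𝓛(M) exactly one infinite run; condition (e) makes the converse map from runs to
-- words injective as well.  Under this correspondence the hypothesis f(s) = f̌(π_s) turns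
-- consistency of a word with f into consistency of its run with f̌, hence 𝓛_f into 𝓟(M, f̌),
-- while the Streett and Rabin conditions translate 𝓛_P and 𝓛_S into 𝓟(M, 𝓕P) and 𝓟(M, 𝓕S).
-- Each of the three clauses of the string-based problem is thereby equivalent to the
-- corresponding clause of the path-based one.
module Submission where

open import Defs
open import Data.Nat using (ℕ; zero; suc)
open import Data.Nat.Properties using (≤-trans; n≤1+n; ≤-pred)
open import Data.Fin using (Fin)
open import Data.Fin.Subset using (Subset; _∈_; ⁅_⁆)
open import Data.Fin.Subset.Properties using (x∈⁅x⁆; x∈⁅y⁆⇒x≡y)
open import Data.List using (List; []; _∷_; _∷ʳ_; length)
open import Data.List.Properties using (∷-injective)
open import Data.Maybe using (just)
open import Data.Maybe.Properties using (just-injective)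
open import Data.Product using (∃-syntax; _×_; _,_; proj₁; proj₂)
open import Data.Product.Function.NonDependent.Propositional using (_×-⇔_)
open import Data.Sum using (inj₁; inj₂)
open import Data.Unit using (tt)
open import Relation.Binary.PropositionalEquality
  using (_≡_; _≗_; refl; sym; trans; cong; subst)
open import Function.Bundles using (_⇔_; mk⇔; module Equivalence)
open import Function.Properties.Equivalence using () renaming (trans to ⇔-trans)

open Equivalence using (to; from)

module Runs {k N : ℕ} (M : FSM k N) where

  private variable
    x x₁ x₂ : Fin N
    σ : Fin k
    s t : List (Fin k)
    π ν : List (Fin N)
    α : ℕ → Fin k
    ρ ρ′ : ℕ → Fin N

  run⇒Steps : Run M x s π → ∃[ ys ] (π ≡ x ∷ ys × Steps M x ys)
  run⇒Steps run-nil = [] , refl , tt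
  run⇒Steps (run-cons d r) with run⇒Steps r
  ... | ys , refl , st = _ ∷ ys , refl , (_ , d) , st

  Steps⇒run : ∀ {ys} → Steps M x ys → ∃[ s ] Run M x s (x ∷ ys)
  Steps⇒run {ys = []} tt = [] , run-nil
  Steps⇒run {ys = _ ∷ _} ((σ , d) , st) =
    let s , r = Steps⇒run st in σ ∷ s , run-cons d r

  PathsOf⇒IsPath : PathsOf M s π → IsPath M π
  PathsOf⇒IsPath r with run⇒Steps r
  ... | _ , refl , st = refl , st

  IsPath⇒PathsOf : IsPath M π → ∃[ s ] PathsOf M s π
  IsPath⇒PathsOf {_ ∷ _} (refl , st) = Steps⇒run st

  run-length : Run M x s π → length π ≡ suc (length s)
  run-length run-nil        = refl
  run-length (run-cons _ r) = cong suc (run-length r)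

  letter-prefix⇒step-prefix : Run M x s π → IsPrefix (t ∷ʳ σ) s →
    ∃[ ν ] ∃[ x₁ ] ∃[ x₂ ]
      (IsPrefix (ν ∷ʳ x₁ ∷ʳ x₂) π × Run M x t (ν ∷ʳ x₁) × InDelta M x₁ σ x₂)
  letter-prefix⇒step-prefix {t = []}    run-nil (_ , ())
  letter-prefix⇒step-prefix {t = _ ∷ _} run-nil (_ , ())
  letter-prefix⇒step-prefix {t = []} (run-cons {y = y} d r) (_ , refl) with run⇒Steps r
  ... | ys , refl , _ = [] , _ , y , (ys , refl) , run-nil , d
  letter-prefix⇒step-prefix {x = x} {t = _ ∷ t} (run-cons d r) (u , e) with ∷-injective e
  ... | refl , e′ with letter-prefix⇒step-prefix {t = t} r (u , e′)
  ... | ν , x₁ , x₂ , (w , eν) , r′ , d′ =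
    x ∷ ν , x₁ , x₂ , (w , cong (x ∷_) eν) , run-cons d r′ , d′

  step-prefix⇒letter-prefix : Run M x s π → IsPrefix (ν ∷ʳ x₁ ∷ʳ x₂) π →
    ∃[ t ] ∃[ σ ] (IsPrefix (t ∷ʳ σ) s × Run M x t (ν ∷ʳ x₁) × InDelta M x₁ σ x₂)
  step-prefix⇒letter-prefix {ν = []}        run-nil (_ , ())
  step-prefix⇒letter-prefix {ν = _ ∷ []}    run-nil (_ , ())
  step-prefix⇒letter-prefix {ν = _ ∷ _ ∷ _} run-nil (_ , ())
  step-prefix⇒letter-prefix {ν = []} (run-cons {σ = σ} {s = s} d r) (_ , e)
    with ∷-injective e | run⇒Steps r
  ... | refl , e′ | _ , refl , _ with ∷-injective e′
  ... | refl , _ = [] , σ , (s , refl) , run-nil , d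
  step-prefix⇒letter-prefix {ν = _ ∷ ν} (run-cons {σ = σ} d r) (u , e) with ∷-injective e
  ... | refl , e′ with step-prefix⇒letter-prefix {ν = ν} r (u , e′)
  ... | t , σ′ , (w , et) , r′ , d′ = σ ∷ t , σ′ , (w , cong (σ ∷_) et) , run-cons d r′ , d′

  takeω-run : (∀ i → InDelta M (ρ i) (α i) (ρ (suc i))) →
    ∀ n → Run M (ρ 0) (takeω n α) (takeω (suc n) ρ)
  takeω-run steps zero    = run-nil
  takeω-run steps (suc n) = run-cons (steps 0) (takeω-run (λ i → steps (suc i)) n)

  PathsOfω⇒PathsOf : PathsOfω M α ρ → ∀ n → PathsOf M (takeω n α) (takeω (suc n) ρ)
  PathsOfω⇒PathsOf {α} {ρ} (ρ₀≡x₀ , steps) n =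
    subst (λ x → Run M x (takeω n α) (takeω (suc n) ρ)) ρ₀≡x₀ (takeω-run steps n)

  PathsOfω⇒IsPathω : PathsOfω M α ρ → IsPathω M ρ
  PathsOfω⇒IsPathω (ρ₀≡x₀ , steps) = ρ₀≡x₀ , λ i → _ , steps i

  IsPathω⇒PathsOfω : IsPathω M ρ → ∃[ α ] PathsOfω M α ρ
  IsPathω⇒PathsOfω (ρ₀≡x₀ , steps) = (λ i → proj₁ (steps i)) , ρ₀≡x₀ , λ i → proj₂ (steps i)

  Inf-cong : ρ ≗ ρ′ → Inf M ρ x → Inf M ρ′ x
  Inf-cong ρ≗ρ′ inf n = let m , n≤m , ρm≡x = inf n in m , n≤m , trans (sym (ρ≗ρ′ m)) ρm≡x

  Rabin-cong : ∀ F → ρ ≗ ρ′ → Rabin M F ρ → Rabin M F ρ′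
  Rabin-cong _ ρ≗ρ′ (i , (x , x∈G , inf) , avoidR) =
    i , (x , x∈G , Inf-cong ρ≗ρ′ inf) , λ y y∈R inf′ → avoidR y y∈R (Inf-cong (λ j → sym (ρ≗ρ′ j)) inf′)

  Streett-cong : ∀ F → ρ ≗ ρ′ → Streett M F ρ → Streett M F ρ′
  Streett-cong _ ρ≗ρ′ streett i with streett i
  ... | inj₁ avoidG          = inj₁ λ y y∈G inf′ → avoidG y y∈G (Inf-cong (λ j → sym (ρ≗ρ′ j)) inf′)
  ... | inj₂ (x , x∈R , inf) = inj₂ (x , x∈R , Inf-cong ρ≗ρ′ inf)

module DeterministicRuns {k N : ℕ} (M : FSM k N) (det : Deterministic M) where

  open Runs M

  private variable
    x y y′ : Fin N
    σ σ′ : Fin k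
    s s′ : List (Fin k)
    π π′ : List (Fin N)
    α : ℕ → Fin k
    ρ ρ′ : ℕ → Fin N

  InDelta⇒δ≡⁅⁆ : InDelta M x σ y → δ M x σ ≡ just ⁅ y ⁆
  InDelta⇒δ≡⁅⁆ {x} {σ} (S , δxσ≡S , y∈S) with det x σ S δxσ≡S
  ... | z , refl rewrite x∈⁅y⁆⇒x≡y z y∈S = δxσ≡S

  InDelta-functional : InDelta M x σ y → InDelta M x σ y′ → y ≡ y′
  InDelta-functional {y = y} {y′ = y′} d d′ =
    x∈⁅y⁆⇒x≡y y′ (subst (y ∈_) (just-injective (trans (sym (InDelta⇒δ≡⁅⁆ d)) (InDelta⇒δ≡⁅⁆ d′)))
                              (x∈⁅x⁆ y))

  run-functional : Run M x s π → Run M x s π′ → π ≡ π′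
  run-functional run-nil        run-nil          = refl
  run-functional (run-cons d r) (run-cons d′ r′) with InDelta-functional d d′
  ... | refl = cong (_ ∷_) (run-functional r r′)

  PathsOfω-functional : PathsOfω M α ρ → PathsOfω M α ρ′ → ρ ≗ ρ′
  PathsOfω-functional (ρ₀≡x₀ , _) (ρ′₀≡x₀ , _) zero = trans ρ₀≡x₀ (sym ρ′₀≡x₀)
  PathsOfω-functional p@(_ , steps) p′@(_ , steps′) (suc i) =
    InDelta-functional (steps i)
      (subst (λ z → InDelta M z _ _) (sym (PathsOfω-functional p p′ i)) (steps′ i))

  LStreett⇔PathsStreett : ∀ F → PathsOfω M α ρ → LStreett M F α ⇔ PathsStreett M F ρ
  LStreett⇔PathsStreett F p = mk⇔
    (λ (ρ′ , p′ , streett) → PathsOfω⇒IsPathω p , Streett-cong F (PathsOfω-functional p′ p) streett)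
    (λ (_ , streett) → _ , p , streett)

  LRabin⇔PathsRabin : ∀ F → PathsOfω M α ρ → LRabin M F α ⇔ PathsRabin M F ρ
  LRabin⇔PathsRabin F p = mk⇔
    (λ (ρ′ , p′ , rabin) → PathsOfω⇒IsPathω p , Rabin-cong F (PathsOfω-functional p′ p) rabin)
    (λ (_ , rabin) → _ , p , rabin)

  prefix-of-word⇒prefix-of-run : PathsOfω M α ρ → PathsOf M s π →
    IsPrefixω s α → IsPrefixω π ρ
  prefix-of-word⇒prefix-of-run {s = s} p r s≡ rewrite run-length r =
    run-functional r (subst (λ w → PathsOf M w _) (sym s≡) (PathsOfω⇒PathsOf p (length s)))

  module _ (dist : DistinctSuccessors M) where

    InDelta-letter : InDelta M x σ y → δ M x σ′ ≡ just ⁅ y ⁆ → σ ≡ σ′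
    InDelta-letter d = dist _ _ _ _ (InDelta⇒δ≡⁅⁆ d)

    run-injective : Run M x s π → Run M x s′ π → s ≡ s′
    run-injective run-nil        run-nil          = refl
    run-injective (run-cons d r) (run-cons d′ r′) with run⇒Steps r | run⇒Steps r′
    ... | _ , refl , _ | _ , refl , _ with InDelta-letter d (InDelta⇒δ≡⁅⁆ d′)
    ... | refl = cong (_ ∷_) (run-injective r r′)

    prefix-of-run⇒prefix-of-word : PathsOfω M α ρ → PathsOf M s π →
      IsPrefixω π ρ → IsPrefixω s α
    prefix-of-run⇒prefix-of-word {ρ = ρ} {s = s} p r π≡ =
      run-injective r (subst (PathsOf M _) (sym (trans π≡ (cong (λ n → takeω n ρ) (run-length r))))
                             (PathsOfω⇒PathsOf p (length s)))

module Supervision {k N : ℕ} (M : FSM k N) (det : Deterministic M) (dist : DistinctSuccessors M)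
  {uc : Subset k} (f : List (Fin k) → Γ uc) (fˇ : List (Fin N) → Γ uc)
  (f≡fˇ : ∀ s π → PathsOf M s π → pat (f s) ≡ pat (fˇ π)) where

  open Runs M
  open DeterministicRuns M det

  private variable
    s : List (Fin k)
    π : List (Fin N)
    α : ℕ → Fin k
    ρ : ℕ → Fin N

  ConsistentStr⇔ConsistentPath : PathsOf M s π → ConsistentStr f s ⇔ ConsistentPath M fˇ π
  ConsistentStr⇔ConsistentPath r = mk⇔ str⇒path path⇒str
    where
    str⇒path : ConsistentStr f _ → ConsistentPath M fˇ _
    str⇒path cs ν x₁ x₂ step≺π =
      let t , σ , tσ≺s , r′ , d = step-prefix⇒letter-prefix r step≺π
      in σ , subst (σ ∈_) (f≡fˇ t _ r′) (cs t σ tσ≺s) , InDelta⇒δ≡⁅⁆ d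

    path⇒str : ConsistentPath M fˇ _ → ConsistentStr f _
    path⇒str cp t σ tσ≺s with letter-prefix⇒step-prefix r tσ≺s
    ... | ν , x₁ , x₂ , step≺π , r′ , d with cp ν x₁ x₂ step≺π
    ... | σ′ , σ′∈fˇ , δ≡ with InDelta-letter dist d δ≡
    ... | refl = subst (σ ∈_) (sym (f≡fˇ t _ r′)) σ′∈fˇ

  Lω-f⇔𝓟-f : PathsOfω M α ρ → Lω-f f α ⇔ 𝓟-f M fˇ ρ
  Lω-f⇔𝓟-f p = mk⇔ word⇒path path⇒word
    where
    word⇒path : Lω-f f _ → 𝓟-f M fˇ _
    word⇒path lim n =
      let m , n≤m , cs = lim n
          r = PathsOfω⇒PathsOf p m
      in suc m , ≤-trans n≤m (n≤1+n m) , PathsOf⇒IsPath r , to (ConsistentStr⇔ConsistentPath r) cs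

    -- a path prefix of length 1 + m is the run of the word prefix of length m
    path⇒word : 𝓟-f M fˇ _ → Lω-f f _
    path⇒word lim n with lim (suc n)
    ... | zero  , () , _
    ... | suc m , 1+n≤1+m , _ , cp =
      m , ≤-pred 1+n≤1+m , from (ConsistentStr⇔ConsistentPath (PathsOfω⇒PathsOf p m)) cp

module Correspondence {k N : ℕ} {uc : Subset k}
  (LP : List (Fin k) → Set) (𝓛P 𝓛S : (ℕ → Fin k) → Set)
  (M : FSM k N) (FP FS : Family M)
  (LP⇔Lstar-M : ∀ s → LP s ⇔ Lstar-M M s)
  (𝓛P⇔LStreett : ∀ α → 𝓛P α ⇔ LStreett M FP α)
  (𝓛S⇔LRabin : ∀ α → 𝓛S α ⇔ LRabin M FS α)
  (det : Deterministic M) (dist : DistinctSuccessors M)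
  (f : List (Fin k) → Γ uc) (fˇ : List (Fin N) → Γ uc)
  (f≡fˇ : ∀ s π → PathsOf M s π → pat (f s) ≡ pat (fˇ π)) where

  open Runs M
  open DeterministicRuns M det
  open Supervision M det dist f fˇ f≡fˇ

  private variable
    α : ℕ → Fin k
    ρ : ℕ → Fin N

  𝓛P⇔PathsStreett : PathsOfω M α ρ → 𝓛P α ⇔ PathsStreett M FP ρ
  𝓛P⇔PathsStreett p = ⇔-trans (𝓛P⇔LStreett _) (LStreett⇔PathsStreett FP p)

  𝓛S⇔PathsRabin : PathsOfω M α ρ → 𝓛S α ⇔ PathsRabin M FS ρ
  𝓛S⇔PathsRabin p = ⇔-trans (𝓛S⇔LRabin _) (LRabin⇔PathsRabin FS p)

  run-of-𝓛P : 𝓛P α → ∃[ ρ ] PathsOfω M α ρ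
  run-of-𝓛P Pα = let ρ , p , _ = to (𝓛P⇔LStreett _) Pα in ρ , p

  controlled-word⇔controlled-path : PathsOfω M α ρ →
    (Lω-f f α × 𝓛P α) ⇔ (𝓟-f M fˇ ρ × PathsStreett M FP ρ)
  controlled-word⇔controlled-path p = Lω-f⇔𝓟-f p ×-⇔ 𝓛P⇔PathsStreett p

  nonblocking⇔ : (∃[ α ] (Lω-f f α × 𝓛P α)) ⇔ (∃[ ρ ] (𝓟-f M fˇ ρ × PathsStreett M FP ρ))
  nonblocking⇔ = mk⇔
    (λ (α , Lα , Pα) → let ρ , p = run-of-𝓛P Pα
                        in ρ , to (controlled-word⇔controlled-path p) (Lα , Pα))
    (λ (ρ , Pρ , ρ∈P) → let α , p = IsPathω⇒PathsOfω (proj₁ ρ∈P)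
                         in α , from (controlled-word⇔controlled-path p) (Pρ , ρ∈P))

  safety⇔ : (∀ α → Lω-f f α → 𝓛P α → 𝓛S α) ⇔
            (∀ ρ → 𝓟-f M fˇ ρ → PathsStreett M FP ρ → PathsRabin M FS ρ)
  safety⇔ = mk⇔
    (λ safe ρ Pρ ρ∈P → let α , p = IsPathω⇒PathsOfω (proj₁ ρ∈P)
                        in to (𝓛S⇔PathsRabin p)
                              (safe α (from (Lω-f⇔𝓟-f p) Pρ) (from (𝓛P⇔PathsStreett p) ρ∈P)))
    (λ safe α Lα Pα → let ρ , p = run-of-𝓛P Pα
                       in from (𝓛S⇔PathsRabin p)
                               (safe ρ (to (Lω-f⇔𝓟-f p) Lα) (to (𝓛P⇔PathsStreett p) Pα)))

  prefixes⇔ : (∀ s → Lstar-f f s → LP s → Preω (λ α → Lω-f f α × 𝓛P α) s) ⇔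
              (∀ π → P-f M fˇ π → Preω (λ ρ → 𝓟-f M fˇ ρ × PathsStreett M FP ρ) π)
  prefixes⇔ = mk⇔
    (λ pre π (π-path , cp) →
      let s , r = IsPath⇒PathsOf π-path
          α , (Lα , Pα) , s≺α = pre s (from (ConsistentStr⇔ConsistentPath r) cp)
                                      (from (LP⇔Lstar-M s) (π , r))
          ρ , p = run-of-𝓛P Pα
      in ρ , to (controlled-word⇔controlled-path p) (Lα , Pα)
           , prefix-of-word⇒prefix-of-run p r s≺α)
    (λ pre s cs LPs →
      let π , r = to (LP⇔Lstar-M s) LPs
          ρ , (Pρ , ρ∈P) , π≺ρ = pre π (PathsOf⇒IsPath r , to (ConsistentStr⇔ConsistentPath r) cs)
          α , p = IsPathω⇒PathsOfω (proj₁ ρ∈P)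
      in α , from (controlled-word⇔controlled-path p) (Pρ , ρ∈P)
           , prefix-of-run⇒prefix-of-word dist p r π≺ρ)

theorem1 : {k N : ℕ} (uc : Subset k)
    (LP : List (Fin k) → Set) (𝓛P 𝓛S : (ℕ → Fin k) → Set) →
    PrefixClosed LP →
    (∀ s → Preω 𝓛P s → LP s) →
    (M : FSM k N) (FP FS : Family M) →
    Realizes M FP FS LP 𝓛P 𝓛S →
    (f : List (Fin k) → Γ uc) (fˇ : List (Fin N) → Γ uc) →
    (∀ s π → PathsOf M s π → pat (f s) ≡ pat (fˇ π)) →
    (SolvesStr f LP 𝓛P 𝓛S ⇔ SolvesPath M fˇ FP FS)
theorem1 uc LP 𝓛P 𝓛S _ _ M FP FS (LP⇔ , 𝓛P⇔ , 𝓛S⇔ , det , dist) f fˇ f≡fˇ =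
  nonblocking⇔ ×-⇔ safety⇔ ×-⇔ prefixes⇔
  where open Correspondence LP 𝓛P 𝓛S M FP FS LP⇔ 𝓛P⇔ 𝓛S⇔ det dist f fˇ f≡fˇ
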